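{- Let $C$ be a simple Chip Firing Game with support graph $G$ and initial configuration $\sigma_0$, whose support graph has a unique sink $\bot$. Let $v\neq\bot$ be a vertex and let $n\ge1$ be an integer. Let $C'$ be obtained from $C$ by the Multiplying Modification, which consists of the following changes: 1. replace $\sigma_0(v)$ by $n\,\sigma_0(v)$; 2. add $(n-1)\,d^+(v)$ edges $(v,\bot)$; 3. for each immediate predecessor $u$ of $v$, add $(n-1)\,d(u,v)$ edges $(u,v)$ and add $(n-1)\,d(u,v)$ chips to the initial configuration of $u$. Here $d^+(v)$ is the outdegree of $v$ and $d(u,v)$ is the number of edges from $u$ to $v$, both in $G$. Then $C'$ is equivalent to $C$.
   Context: A Chip Firing Game (CFG) is played on a finite directed multigraph with an initial configuration $\sigma_0:V\to\mathbb{N}$ of chips. A vertex $v$ with at least one outgoing edge and at least $d^+(v)$ chips may be fired, sending one chip along each outgoing edge. A sink is a vertex with no outgoing edges. The configuration space is the set of configurations reachable from $\sigma_0$, ordered by reachability. The game is convergent if it reaches a final configuration in which no firing is possible. An execution is a firing sequence from the initial configuration to the final one. A convergent CFG is simple if each vertex is fired at most once during an execution. Two convergent CFGs are equivalent if their configuration spaces are isomorphic posets. Standing assumptions: the support graph has no loops, and every vertex other than $\bot$ is fired during an execution. -}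

module Defs where

open import Data.Nat using (ℕ; zero; suc; _+_; _*_; _∸_; _≤_; _<_)
open import Data.Fin using (Fin; _≟_)
open import Data.Vec using (Vec; lookup; tabulate)
open import Data.List using (List; []; _∷_; map; allFin)
open import Data.Nat.ListAction using (sum)
open import Data.Product using (Σ; ∃; _×_; _,_; proj₁)
open import Data.Bool using (if_then_else_)
open import Relation.Nullary using (¬_; does)
open import Relation.Binary.PropositionalEquality using (_≡_)
open import Relation.Binary.Construct.Closure.ReflexiveTransitive using (Star)

-- A directed multigraph on the vertex set Fin k, given by edge multiplicities:
-- d u w = number of edges from u to w.
Graph : ℕ → Set
Graph k = Fin k → Fin k → ℕ

Config : ℕ → Set
Config k = Vec ℕ k

module _ {k : ℕ} where

  outdeg : Graph k → Fin k → ℕ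
  outdeg d v = sum (map (d v) (allFin k))

  NoLoops : Graph k → Set
  NoLoops d = ∀ v → d v v ≡ 0

  IsSink : Graph k → Fin k → Set
  IsSink d v = outdeg d v ≡ 0

  UniqueSink : Graph k → Fin k → Set
  UniqueSink d b = IsSink d b × (∀ v → IsSink d v → v ≡ b)

  Fireable : Graph k → Config k → Fin k → Set
  Fireable d σ v = 0 < outdeg d v × outdeg d v ≤ lookup σ v

  fire : Graph k → Config k → Fin k → Config k
  fire d σ v = tabulate λ w →
    if does (w ≟ v) then (lookup σ w ∸ outdeg d v) + d v w
                    else lookup σ w + d v w

  Step : Graph k → Config k → Config k → Set
  Step d σ τ = ∃ λ v → Fireable d σ v × τ ≡ fire d σ v

  Reach : Graph k → Config k → Config k → Set
  Reach d = Star (Step d)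

  Final : Graph k → Config k → Set
  Final d σ = ∀ v → ¬ Fireable d σ v

  data FiringSeq (d : Graph k) : Config k → List (Fin k) → Config k → Set where
    done : ∀ {σ} → FiringSeq d σ [] σ
    step : ∀ {σ v vs τ} → Fireable d σ v →
           FiringSeq d (fire d σ v) vs τ → FiringSeq d σ (v ∷ vs) τ

  Execution : Graph k → Config k → List (Fin k) → Set
  Execution d σ₀ vs = ∃ λ τ → FiringSeq d σ₀ vs τ × Final d τ

  occ : Fin k → List (Fin k) → ℕ
  occ v [] = 0
  occ v (w ∷ ws) = if does (v ≟ w) then suc (occ v ws) else occ v ws

  Convergent : Graph k → Config k → Set
  Convergent d σ₀ = ∃ λ τ → Reach d σ₀ τ × Final d τ

  Simple : Graph k → Config k → Set
  Simple d σ₀ = Convergent d σ₀ ×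
    (∀ vs → Execution d σ₀ vs → ∀ v → occ v vs ≤ 1)

  -- standing assumption: every vertex other than ⊥ is fired during an execution
  AllButSinkFired : Graph k → Config k → Fin k → Set
  AllButSinkFired d σ₀ b =
    ∀ vs → Execution d σ₀ vs → ∀ v → ¬ v ≡ b → 1 ≤ occ v vs

  Space : Graph k → Config k → Set
  Space d σ₀ = Σ (Config k) (Reach d σ₀)

record Equivalent {k k' : ℕ} (d : Graph k) (σ₀ : Config k)
                  (d' : Graph k') (σ₀' : Config k') : Set where
  field
    to      : Space d σ₀ → Space d' σ₀'
    from    : Space d' σ₀' → Space d σ₀
    from∘to : ∀ x → proj₁ (from (to x)) ≡ proj₁ x
    to∘from : ∀ y → proj₁ (to (from y)) ≡ proj₁ y
    to-mono : ∀ x y → Reach d (proj₁ x) (proj₁ y) →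
              Reach d' (proj₁ (to x)) (proj₁ (to y))
    to-refl : ∀ x y → Reach d' (proj₁ (to x)) (proj₁ (to y)) →
              Reach d (proj₁ x) (proj₁ y)

module _ {k : ℕ} where
  multGraph : Graph k → Fin k → Fin k → ℕ → Graph k
  multGraph d b v n x y =
    d x y
    + (if does (x ≟ v) then (if does (y ≟ b) then (n ∸ 1) * outdeg d v else 0) else 0)
    + (if does (y ≟ v) then (n ∸ 1) * d x v else 0)

  multConfig : Graph k → Config k → Fin k → ℕ → Config k
  multConfig d σ₀ v n = tabulate λ x →
    if does (x ≟ v) then n * lookup σ₀ v
                    else lookup σ₀ x + (n ∸ 1) * d x v

-- Compare the two games through a map lift σ c, where c records which vertices have
-- already fired: it multiplies the chips on v by n and adds to every other vertex the
-- chips it holds in C' beyond those it holds in C (see surplus). A vertex that has not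
-- fired yet is fireable at lift σ c iff it is fireable at σ, and firing it commutes with
-- lift; so firing sequences of C and C' correspond vertex by vertex. Since C is simple, a
-- fireable vertex has not fired yet, and since every execution fires each non-sink vertex
-- exactly once, in both games the reached configuration determines which vertices have
-- fired. This makes the correspondence a well-defined order isomorphism of the
-- configuration spaces.

module Submission where

open import Defs
open import Data.Nat using (ℕ; zero; suc; _+_; _*_; _∸_; _≤_; _<_; z<s)
open import Data.Nat.Properties hiding (_≟_)
open import Data.Nat.ListAction using (sum)
open import Data.Fin using (Fin; zero; suc; _≟_)
open import Data.List using (List; []; _∷_; _++_; map; allFin)
import Data.List as List
open import Data.List.Properties using (map-tabulate; ++-identityʳ; ++-assoc)
open import Data.Vec using (Vec; lookup; tabulate)
open import Data.Vec.Properties using (lookup∘tabulate; tabulate∘lookup; tabulate-cong)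
open import Data.Bool using (true; false; if_then_else_)
open import Data.Product using (∃; _×_; _,_; proj₁; proj₂)
open import Relation.Nullary using (¬_; Dec; does; yes; no)
open import Relation.Nullary.Decidable using (dec-true; dec-false)
open import Relation.Nullary.Negation using (contradiction)
open import Relation.Binary.PropositionalEquality
open import Relation.Binary.Construct.Closure.ReflexiveTransitive using (ε; _◅_)
open import Algebra.Properties.CommutativeSemigroup +-commutativeSemigroup using (xy∙z≈xz∙y; interchange)
open import Algebra.Properties.CommutativeMonoid.Sum +-0-commutativeMonoid
  using (∑-distrib-+; sum-replicate-zero) renaming (sum to ∑)

lookup-ext : ∀ {k} {xs ys : Vec ℕ k} → (∀ i → lookup xs i ≡ lookup ys i) → xs ≡ ys
lookup-ext {xs = xs} {ys} eq =
  trans (sym (tabulate∘lookup xs)) (trans (tabulate-cong eq) (tabulate∘lookup ys))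

module _ {k : ℕ} {A : Set} {x y : Fin k} {a a' : A} where

  if-≟-yes : x ≡ y → (if does (x ≟ y) then a else a') ≡ a
  if-≟-yes x≡y rewrite dec-true (x ≟ y) x≡y = refl

  if-≟-no : ¬ x ≡ y → (if does (x ≟ y) then a else a') ≡ a'
  if-≟-no x≢y rewrite dec-false (x ≟ y) x≢y = refl

sum-allFin : ∀ {k} (f : Fin k → ℕ) → sum (map f (allFin k)) ≡ ∑ f
sum-allFin f = trans (cong sum (map-tabulate (λ i → i) f)) (sum-tabulate f)
  where
  sum-tabulate : ∀ {k} (f : Fin k → ℕ) → sum (List.tabulate f) ≡ ∑ f
  sum-tabulate {zero} f = refl
  sum-tabulate {suc k} f = cong (f zero +_) (sum-tabulate (λ i → f (suc i)))

∑-indicator : ∀ {k} (b : Fin k) (K : ℕ) → ∑ (λ y → if does (y ≟ b) then K else 0) ≡ K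
∑-indicator {suc k} zero K = trans (cong (K +_) (sum-replicate-zero k)) (+-identityʳ K)
∑-indicator {suc k} (suc b) K = ∑-indicator b K

term≤∑ : ∀ {k} (f : Fin k → ℕ) i → f i ≤ ∑ f
term≤∑ f zero = m≤m+n _ _
term≤∑ f (suc i) = ≤-trans (term≤∑ (λ j → f (suc j)) i) (m≤n+m _ _)

m*n>0⇒n>0 : ∀ m {n} → 0 < m * n → 0 < n
m*n>0⇒n>0 m {zero} m*0>0 = contradiction (*-zeroʳ m) (n>0⇒n≢0 m*0>0)
m*n>0⇒n>0 m {suc n} _ = z<s

module _ {k : ℕ} where

  occ-++ : ∀ (x : Fin k) p q → occ x (p ++ q) ≡ occ x p + occ x q
  occ-++ x [] q = refl
  occ-++ x (w ∷ p) q with does (x ≟ w)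
  ... | true = cong suc (occ-++ x p q)
  ... | false = occ-++ x p q

  occ-self : ∀ (x : Fin k) → occ x (x ∷ []) ≡ 1
  occ-self x = if-≟-yes {x = x} refl

  occ-other : ∀ {x w : Fin k} → ¬ x ≡ w → occ x (w ∷ []) ≡ 0
  occ-other = if-≟-no

  occs : List (Fin k) → Fin k → ℕ
  occs q x = occ x q

module Game {k : ℕ} (D : Graph k) where

  Reach⇒FiringSeq : ∀ {σ τ} → Reach D σ τ → ∃ λ vs → FiringSeq D σ vs τ
  Reach⇒FiringSeq ε = [] , done
  Reach⇒FiringSeq ((v , fv , refl) ◅ r) =
    let vs , s = Reach⇒FiringSeq r in v ∷ vs , step fv s

  FiringSeq⇒Reach : ∀ {σ vs τ} → FiringSeq D σ vs τ → Reach D σ τ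
  FiringSeq⇒Reach done = ε
  FiringSeq⇒Reach (step {v = v} fv s) = (v , fv , refl) ◅ FiringSeq⇒Reach s

  infixr 5 _++ᶠ_
  _++ᶠ_ : ∀ {σ p τ q ρ} → FiringSeq D σ p τ → FiringSeq D τ q ρ → FiringSeq D σ (p ++ q) ρ
  done ++ᶠ t = t
  step f s ++ᶠ t = step f (s ++ᶠ t)

  [_]ᶠ : ∀ {σ w} → Fireable D σ w → FiringSeq D σ (w ∷ []) (fire D σ w)
  [ f ]ᶠ = step f done

  outdeg≡∑ : ∀ x → outdeg D x ≡ ∑ (D x)
  outdeg≡∑ x = sum-allFin (D x)

  edge≤outdeg : ∀ x y → D x y ≤ outdeg D x
  edge≤outdeg x y = subst (D x y ≤_) (sym (outdeg≡∑ x)) (term≤∑ (D x) y)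

  positive⇒≢sink : ∀ {b w} → IsSink D b → 0 < outdeg D w → ¬ w ≡ b
  positive⇒≢sink b-sink positive refl = <-irrefl (sym b-sink) positive

  lookup-fire : ∀ σ w x → lookup (fire D σ w) x ≡
    (if does (x ≟ w) then lookup σ x ∸ outdeg D w + D w x else lookup σ x + D w x)
  lookup-fire σ w = lookup∘tabulate _

  lookup-fire-self : ∀ σ w → lookup (fire D σ w) w ≡ lookup σ w ∸ outdeg D w + D w w
  lookup-fire-self σ w = trans (lookup-fire σ w w) (if-≟-yes {x = w} refl)

  lookup-fire-other : ∀ σ w {x} → ¬ x ≡ w → lookup (fire D σ w) x ≡ lookup σ x + D w x
  lookup-fire-other σ w {x} x≢w = trans (lookup-fire σ w x) (if-≟-no x≢w)

  Fireable-fire : ∀ σ {a w} → ¬ w ≡ a → Fireable D σ w → Fireable D (fire D σ a) w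
  Fireable-fire σ {a} {w} w≢a (positive , enough) = positive ,
    subst (outdeg D w ≤_) (sym (lookup-fire-other σ a w≢a)) (≤-trans enough (m≤m+n _ _))

  lookup-fire-fire-self : ∀ σ {x w} → ¬ x ≡ w → outdeg D x ≤ lookup σ x →
    lookup (fire D (fire D σ x) w) x ≡ lookup (fire D (fire D σ w) x) x
  lookup-fire-fire-self σ {x} {w} x≢w enough = begin
    lookup (fire D (fire D σ x) w) x           ≡⟨ lookup-fire-other (fire D σ x) w x≢w ⟩
    lookup (fire D σ x) x + D w x              ≡⟨ cong (_+ D w x) (lookup-fire-self σ x) ⟩
    lookup σ x ∸ outdeg D x + D x x + D w x    ≡⟨ xy∙z≈xz∙y _ (D x x) (D w x) ⟩
    lookup σ x ∸ outdeg D x + D w x + D x x    ≡⟨ cong (_+ D x x) (+-∸-comm (D w x) enough) ⟨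
    lookup σ x + D w x ∸ outdeg D x + D x x    ≡⟨ cong (λ y → y ∸ outdeg D x + D x x) (lookup-fire-other σ w x≢w) ⟨
    lookup (fire D σ w) x ∸ outdeg D x + D x x ≡⟨ lookup-fire-self (fire D σ w) x ⟨
    lookup (fire D (fire D σ w) x) x           ∎
    where open ≡-Reasoning

  fire-comm : ∀ σ {a w} → ¬ a ≡ w → Fireable D σ a → Fireable D σ w →
    fire D (fire D σ a) w ≡ fire D (fire D σ w) a
  fire-comm σ {a} {w} a≢w (_ , a-enough) (_ , w-enough) = lookup-ext entry
    where
    entry : ∀ x → lookup (fire D (fire D σ a) w) x ≡ lookup (fire D (fire D σ w) a) x
    entry x with x ≟ a | x ≟ w
    ... | yes refl | yes refl = contradiction refl a≢w
    ... | yes refl | no x≢w = lookup-fire-fire-self σ x≢w a-enough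
    ... | no x≢a | yes refl = sym (lookup-fire-fire-self σ x≢a w-enough)
    ... | no x≢a | no x≢w = begin
      lookup (fire D (fire D σ a) w) x ≡⟨ lookup-fire-other (fire D σ a) w x≢w ⟩
      lookup (fire D σ a) x + D w x    ≡⟨ cong (_+ D w x) (lookup-fire-other σ a x≢a) ⟩
      lookup σ x + D a x + D w x       ≡⟨ xy∙z≈xz∙y (lookup σ x) (D a x) (D w x) ⟩
      lookup σ x + D w x + D a x       ≡⟨ cong (_+ D a x) (lookup-fire-other σ w x≢w) ⟨
      lookup (fire D σ w) x + D a x    ≡⟨ lookup-fire-other (fire D σ w) a x≢a ⟨
      lookup (fire D (fire D σ w) a) x ∎
      where open ≡-Reasoning

  -- the first firing of the execution is either w itself or commutes with w
  Execution-fire : ∀ {σ e w} → Fireable D σ w → Execution D σ e → ∃ (Execution D (fire D σ w))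
  Execution-fire w-fireable (τ , done , final) = contradiction w-fireable (final _)
  Execution-fire {σ} {w = w} w-fireable (τ , step {v = a} a-fireable s , final) with a ≟ w
  ... | yes refl = _ , τ , s , final
  ... | no a≢w =
    let e' , τ' , s' , final' =
          Execution-fire (Fireable-fire σ (λ w≡a → a≢w (sym w≡a)) w-fireable) (τ , s , final)
    in a ∷ e' , τ' ,
       step (Fireable-fire σ a≢w a-fireable)
            (subst (λ ρ → FiringSeq D ρ e' τ') (fire-comm σ a≢w a-fireable w-fireable) s') ,
       final'

  Execution-extend : ∀ {σ p τ e} → FiringSeq D σ p τ → Execution D σ e → ∃ (Execution D τ)
  Execution-extend done ex = _ , ex
  Execution-extend (step f s) ex = Execution-extend s (proj₂ (Execution-fire f ex))

  Convergent⇒Execution : ∀ {σ₀} → Convergent D σ₀ → ∃ (Execution D σ₀)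
  Convergent⇒Execution (τ , r , final) =
    let e , s = Reach⇒FiringSeq r in e , τ , s , final

  occ-sink : ∀ {b σ p τ} → IsSink D b → FiringSeq D σ p τ → occ b p ≡ 0
  occ-sink b-sink done = refl
  occ-sink {b} b-sink (step {v = w} (positive , _) s) with b ≟ w
  ... | yes b≡w = contradiction (sym b≡w) (positive⇒≢sink b-sink positive)
  ... | no _ = occ-sink b-sink s

  ExecutionsAgree : Config k → Set
  ExecutionsAgree σ₀ =
    ∀ {e e'} → Execution D σ₀ e → Execution D σ₀ e' → ∀ x → occ x e ≡ occ x e'

  -- both sequences extend, by the same firings, to executions
  occ-determined : ∀ {σ₀ e P Q ρ} → ExecutionsAgree σ₀ → Execution D σ₀ e →
    FiringSeq D σ₀ P ρ → FiringSeq D σ₀ Q ρ → ∀ x → occ x P ≡ occ x Q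
  occ-determined {P = P} {Q} agree ex sP sQ x with Execution-extend sP ex
  ... | r , τ , sr , final = +-cancelʳ-≡ (occ x r) _ _ (begin
    occ x P + occ x r ≡⟨ occ-++ x P r ⟨
    occ x (P ++ r)    ≡⟨ agree (τ , sP ++ᶠ sr , final) (τ , sQ ++ᶠ sr , final) x ⟩
    occ x (Q ++ r)    ≡⟨ occ-++ x Q r ⟩
    occ x Q + occ x r ∎)
    where open ≡-Reasoning

  Fireable⇒unfired : ∀ {σ₀ q σ w} → Simple D σ₀ →
    FiringSeq D σ₀ q σ → Fireable D σ w → occ w q ≡ 0
  Fireable⇒unfired {q = q} {w = w} (convergent , at-most-once) s w-fireable
    with Execution-extend (s ++ᶠ [ w-fireable ]ᶠ) (proj₂ (Convergent⇒Execution convergent))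
  ... | r , τ , sr , final = n≤0⇒n≡0 (+-cancelʳ-≤ 1 (occ w q) 0 (begin
    occ w q + 1                  ≡⟨ cong (occ w q +_) (occ-self w) ⟨
    occ w q + occ w (w ∷ [])     ≡⟨ occ-++ w q (w ∷ []) ⟨
    occ w (q ++ w ∷ [])          ≤⟨ m≤m+n _ _ ⟩
    occ w (q ++ w ∷ []) + occ w r ≡⟨ occ-++ w (q ++ w ∷ []) r ⟨
    occ w ((q ++ w ∷ []) ++ r)   ≤⟨ at-most-once _ (τ , (s ++ᶠ [ w-fireable ]ᶠ) ++ᶠ sr , final) w ⟩
    1                            ∎))
    where open ≤-Reasoning

module Multiplying {k : ℕ} (d : Graph k) (b v : Fin k) (m : ℕ)
  (noLoops : NoLoops d) (b-sink : IsSink d b) (v≢b : ¬ v ≡ b) where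

  n : ℕ
  n = suc m

  d' : Graph k
  d' = multGraph d b v n

  module C = Game d
  module C' = Game d'

  d'-v-v : d' v v ≡ 0
  d'-v-v rewrite dec-true (v ≟ v) refl | dec-false (v ≟ b) v≢b | noLoops v = *-zeroʳ m

  d'-from-v : ∀ {x} → ¬ x ≡ v → d' v x ≡ d v x + (if does (x ≟ b) then m * outdeg d v else 0)
  d'-from-v {x} x≢v rewrite dec-true (v ≟ v) refl | dec-false (x ≟ v) x≢v = +-identityʳ _

  d'-to-v : ∀ {w} → ¬ w ≡ v → d' w v ≡ n * d w v
  d'-to-v {w} w≢v rewrite dec-false (w ≟ v) w≢v | dec-true (v ≟ v) refl =
    cong (_+ m * d w v) (+-identityʳ _)

  d'-away-from-v : ∀ {w x} → ¬ w ≡ v → ¬ x ≡ v → d' w x ≡ d w x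
  d'-away-from-v {w} {x} w≢v x≢v rewrite dec-false (w ≟ v) w≢v | dec-false (x ≟ v) x≢v =
    trans (+-identityʳ _) (+-identityʳ _)

  outdeg-d' : ∀ x →
    outdeg d' x ≡ outdeg d x + (if does (x ≟ v) then m * outdeg d v else 0) + m * d x v
  outdeg-d' x = begin
    outdeg d' x
      ≡⟨ C'.outdeg≡∑ x ⟩
    ∑ (λ y → d x y + toSink y + toV y)
      ≡⟨ ∑-distrib-+ (λ y → d x y + toSink y) toV ⟩
    ∑ (λ y → d x y + toSink y) + ∑ toV
      ≡⟨ cong₂ _+_ (∑-distrib-+ (d x) toSink) (∑-indicator v (m * d x v)) ⟩
    ∑ (d x) + ∑ toSink + m * d x v
      ≡⟨ cong₂ (λ o e → o + e + m * d x v) (sym (C.outdeg≡∑ x)) ∑toSink ⟩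
    outdeg d x + (if does (x ≟ v) then m * outdeg d v else 0) + m * d x v ∎
    where
    open ≡-Reasoning
    toSink toV : Fin k → ℕ
    toSink y = if does (x ≟ v) then (if does (y ≟ b) then m * outdeg d v else 0) else 0
    toV y = if does (y ≟ v) then m * d x v else 0
    ∑toSink : ∑ toSink ≡ (if does (x ≟ v) then m * outdeg d v else 0)
    ∑toSink with does (x ≟ v)
    ... | true = ∑-indicator b (m * outdeg d v)
    ... | false = sum-replicate-zero k

  outdeg-d'-v : outdeg d' v ≡ n * outdeg d v
  outdeg-d'-v rewrite outdeg-d' v | dec-true (v ≟ v) refl | noLoops v | *-zeroʳ m = +-identityʳ _

  outdeg-d'-other : ∀ {w} → ¬ w ≡ v → outdeg d' w ≡ outdeg d w + m * d w v
  outdeg-d'-other {w} w≢v rewrite outdeg-d' w | dec-false (w ≟ v) w≢v =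
    cong (_+ m * d w v) (+-identityʳ _)

  -- c x counts the firings of x so far: until it fires, a vertex x ≠ v keeps the
  -- m·d(x,v) chips added for its extra edges to v, and once v has fired the sink
  -- holds the m·d⁺(v) chips v sent along its extra edges.
  surplus : (Fin k → ℕ) → Fin k → ℕ
  surplus c x = m * d x v * (1 ∸ c x) + (if does (x ≟ b) then m * outdeg d v * c v else 0)

  lift : Config k → (Fin k → ℕ) → Config k
  lift σ c = tabulate λ x → if does (x ≟ v) then n * lookup σ v else lookup σ x + surplus c x

  _⊕_ : (Fin k → ℕ) → Fin k → Fin k → ℕ
  (c ⊕ w) x = c x + occ x (w ∷ [])

  lookup-lift-v : ∀ σ c → lookup (lift σ c) v ≡ n * lookup σ v
  lookup-lift-v σ c = trans (lookup∘tabulate _ v) (if-≟-yes {x = v} refl)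

  lookup-lift-other : ∀ σ c {x} → ¬ x ≡ v → lookup (lift σ c) x ≡ lookup σ x + surplus c x
  lookup-lift-other σ c {x} x≢v = trans (lookup∘tabulate _ x) (if-≟-no x≢v)

  lift-cong : ∀ σ {c c'} → (∀ x → c x ≡ c' x) → lift σ c ≡ lift σ c'
  lift-cong σ c≗c' = tabulate-cong λ x →
    cong (λ s → if does (x ≟ v) then n * lookup σ v else lookup σ x + s)
         (cong₂ (λ cx cv → m * d x v * (1 ∸ cx) + (if does (x ≟ b) then m * outdeg d v * cv else 0))
                (c≗c' x) (c≗c' v))

  lift-injective : ∀ {σ₁ σ₂} c → lift σ₁ c ≡ lift σ₂ c → σ₁ ≡ σ₂
  lift-injective {σ₁} {σ₂} c eq = lookup-ext entry
    where
    entry : ∀ x → lookup σ₁ x ≡ lookup σ₂ x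
    entry x with x ≟ v
    ... | yes refl = *-cancelˡ-≡ _ _ n (begin
      n * lookup σ₁ v     ≡⟨ lookup-lift-v σ₁ c ⟨
      lookup (lift σ₁ c) v ≡⟨ cong (λ σ → lookup σ v) eq ⟩
      lookup (lift σ₂ c) v ≡⟨ lookup-lift-v σ₂ c ⟩
      n * lookup σ₂ v     ∎)
      where open ≡-Reasoning
    ... | no x≢v = +-cancelʳ-≡ (surplus c x) _ _ (begin
      lookup σ₁ x + surplus c x ≡⟨ lookup-lift-other σ₁ c x≢v ⟨
      lookup (lift σ₁ c) x      ≡⟨ cong (λ σ → lookup σ x) eq ⟩
      lookup (lift σ₂ c) x      ≡⟨ lookup-lift-other σ₂ c x≢v ⟩
      lookup σ₂ x + surplus c x ∎)
      where open ≡-Reasoning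

  surplus-initial : ∀ x → surplus (λ _ → 0) x ≡ m * d x v
  surplus-initial x rewrite *-zeroʳ (m * outdeg d v) | *-identityʳ (m * d x v) with does (x ≟ b)
  ... | true = +-identityʳ _
  ... | false = +-identityʳ _

  lift-initial : ∀ σ₀ → lift σ₀ (λ _ → 0) ≡ multConfig d σ₀ v n
  lift-initial σ₀ = tabulate-cong λ x →
    cong (λ s → if does (x ≟ v) then n * lookup σ₀ v else lookup σ₀ x + s) (surplus-initial x)

  surplus-unfired : ∀ c {x} → c x ≡ 0 → ¬ x ≡ b → surplus c x ≡ m * d x v
  surplus-unfired c {x} cx≡0 x≢b rewrite cx≡0 | dec-false (x ≟ b) x≢b =
    trans (+-identityʳ _) (*-identityʳ _)

  surplus≤ : ∀ c {x} → ¬ x ≡ b → surplus c x ≤ m * d x v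
  surplus≤ c {x} x≢b rewrite dec-false (x ≟ b) x≢b = begin
    m * d x v * (1 ∸ c x) + 0 ≡⟨ +-identityʳ _ ⟩
    m * d x v * (1 ∸ c x)     ≤⟨ *-monoʳ-≤ (m * d x v) (m∸n≤m 1 (c x)) ⟩
    m * d x v * 1             ≡⟨ *-identityʳ _ ⟩
    m * d x v                 ∎
    where open ≤-Reasoning

  surplus-⊕-self : ∀ c {w} → c w ≡ 0 → ¬ w ≡ b → surplus (c ⊕ w) w ≡ 0
  surplus-⊕-self c {w} cw≡0 w≢b
    rewrite cw≡0 | occ-self w | dec-false (w ≟ b) w≢b | *-zeroʳ (m * d w v) = refl

  surplus-⊕-other : ∀ c {w x} → ¬ x ≡ w → ¬ v ≡ w → surplus (c ⊕ w) x ≡ surplus c x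
  surplus-⊕-other c {w} {x} x≢w v≢w
    rewrite occ-other x≢w | occ-other v≢w | +-identityʳ (c x) | +-identityʳ (c v) = refl

  surplus-⊕-v : ∀ c {x} → c v ≡ 0 → ¬ x ≡ v →
    surplus (c ⊕ v) x ≡ surplus c x + (if does (x ≟ b) then m * outdeg d v else 0)
  surplus-⊕-v c {x} cv≡0 x≢v
    rewrite occ-other x≢v | occ-self v | cv≡0 | +-identityʳ (c x) | *-zeroʳ (m * outdeg d v)
          | *-identityʳ (m * outdeg d v) with does (x ≟ b)
  ... | true = cong (_+ m * outdeg d v) (sym (+-identityʳ _))
  ... | false = sym (+-identityʳ _)

  module _ (σ : Config k) (c : Fin k → ℕ) where
    open ≡-Reasoning

    fire-lift-v-at-v : lookup (fire d' (lift σ c) v) v ≡ lookup (lift (fire d σ v) (c ⊕ v)) v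
    fire-lift-v-at-v = begin
      lookup (fire d' (lift σ c) v) v                ≡⟨ C'.lookup-fire-self (lift σ c) v ⟩
      lookup (lift σ c) v ∸ outdeg d' v + d' v v     ≡⟨ cong₂ (λ a o → a ∸ o + d' v v) (lookup-lift-v σ c) outdeg-d'-v ⟩
      n * lookup σ v ∸ n * outdeg d v + d' v v       ≡⟨ cong (n * lookup σ v ∸ n * outdeg d v +_) d'-v-v ⟩
      n * lookup σ v ∸ n * outdeg d v + 0            ≡⟨ +-identityʳ _ ⟩
      n * lookup σ v ∸ n * outdeg d v                ≡⟨ *-distribˡ-∸ n (lookup σ v) (outdeg d v) ⟨
      n * (lookup σ v ∸ outdeg d v)                  ≡⟨ cong (n *_) (+-identityʳ _) ⟨
      n * (lookup σ v ∸ outdeg d v + 0)              ≡⟨ cong (λ e → n * (lookup σ v ∸ outdeg d v + e)) (noLoops v) ⟨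
      n * (lookup σ v ∸ outdeg d v + d v v)          ≡⟨ cong (n *_) (C.lookup-fire-self σ v) ⟨
      n * lookup (fire d σ v) v                      ≡⟨ lookup-lift-v (fire d σ v) (c ⊕ v) ⟨
      lookup (lift (fire d σ v) (c ⊕ v)) v           ∎

    fire-lift-v-elsewhere : c v ≡ 0 → ∀ {x} → ¬ x ≡ v →
      lookup (fire d' (lift σ c) v) x ≡ lookup (lift (fire d σ v) (c ⊕ v)) x
    fire-lift-v-elsewhere cv≡0 {x} x≢v = begin
      lookup (fire d' (lift σ c) v) x                     ≡⟨ C'.lookup-fire-other (lift σ c) v x≢v ⟩
      lookup (lift σ c) x + d' v x                        ≡⟨ cong₂ _+_ (lookup-lift-other σ c x≢v) (d'-from-v x≢v) ⟩
      lookup σ x + surplus c x + (d v x + toSink)         ≡⟨ interchange (lookup σ x) (surplus c x) (d v x) toSink ⟩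
      lookup σ x + d v x + (surplus c x + toSink)         ≡⟨ cong₂ _+_ (C.lookup-fire-other σ v x≢v) (surplus-⊕-v c cv≡0 x≢v) ⟨
      lookup (fire d σ v) x + surplus (c ⊕ v) x           ≡⟨ lookup-lift-other (fire d σ v) (c ⊕ v) x≢v ⟨
      lookup (lift (fire d σ v) (c ⊕ v)) x                ∎
      where
      toSink : ℕ
      toSink = if does (x ≟ b) then m * outdeg d v else 0

    fire-lift-other-at-v : ∀ {w} → ¬ w ≡ v →
      lookup (fire d' (lift σ c) w) v ≡ lookup (lift (fire d σ w) (c ⊕ w)) v
    fire-lift-other-at-v {w} w≢v = begin
      lookup (fire d' (lift σ c) w) v          ≡⟨ C'.lookup-fire-other (lift σ c) w v≢w ⟩
      lookup (lift σ c) v + d' w v             ≡⟨ cong₂ _+_ (lookup-lift-v σ c) (d'-to-v w≢v) ⟩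
      n * lookup σ v + n * d w v               ≡⟨ *-distribˡ-+ n (lookup σ v) (d w v) ⟨
      n * (lookup σ v + d w v)                 ≡⟨ cong (n *_) (C.lookup-fire-other σ w v≢w) ⟨
      n * lookup (fire d σ w) v                ≡⟨ lookup-lift-v (fire d σ w) (c ⊕ w) ⟨
      lookup (lift (fire d σ w) (c ⊕ w)) v     ∎
      where
      v≢w : ¬ v ≡ w
      v≢w v≡w = w≢v (sym v≡w)

    fire-lift-other-at-self : ∀ {w} → c w ≡ 0 → ¬ w ≡ v → ¬ w ≡ b →
      lookup (fire d' (lift σ c) w) w ≡ lookup (lift (fire d σ w) (c ⊕ w)) w
    fire-lift-other-at-self {w} cw≡0 w≢v w≢b = begin
      lookup (fire d' (lift σ c) w) w
        ≡⟨ C'.lookup-fire-self (lift σ c) w ⟩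
      lookup (lift σ c) w ∸ outdeg d' w + d' w w
        ≡⟨ cong₂ _+_ (cong₂ _∸_ lifted (outdeg-d'-other w≢v)) (d'-away-from-v w≢v w≢v) ⟩
      lookup σ w + m * d w v ∸ (outdeg d w + m * d w v) + d w w
        ≡⟨ cong (_+ d w w) (cancel (lookup σ w) (outdeg d w) (m * d w v)) ⟩
      lookup σ w ∸ outdeg d w + d w w
        ≡⟨ +-identityʳ _ ⟨
      lookup σ w ∸ outdeg d w + d w w + 0
        ≡⟨ cong₂ _+_ (C.lookup-fire-self σ w) (surplus-⊕-self c cw≡0 w≢b) ⟨
      lookup (fire d σ w) w + surplus (c ⊕ w) w
        ≡⟨ lookup-lift-other (fire d σ w) (c ⊕ w) w≢v ⟨
      lookup (lift (fire d σ w) (c ⊕ w)) w ∎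
      where
      lifted : lookup (lift σ c) w ≡ lookup σ w + m * d w v
      lifted = trans (lookup-lift-other σ c w≢v) (cong (lookup σ w +_) (surplus-unfired c cw≡0 w≢b))
      cancel : ∀ a o e → a + e ∸ (o + e) ≡ a ∸ o
      cancel a o e = trans (cong₂ _∸_ (+-comm a e) (+-comm o e)) ([m+n]∸[m+o]≡n∸o e a o)

    fire-lift-other-elsewhere : ∀ {w x} → ¬ w ≡ v → ¬ x ≡ v → ¬ x ≡ w →
      lookup (fire d' (lift σ c) w) x ≡ lookup (lift (fire d σ w) (c ⊕ w)) x
    fire-lift-other-elsewhere {w} {x} w≢v x≢v x≢w = begin
      lookup (fire d' (lift σ c) w) x              ≡⟨ C'.lookup-fire-other (lift σ c) w x≢w ⟩
      lookup (lift σ c) x + d' w x                 ≡⟨ cong₂ _+_ (lookup-lift-other σ c x≢v) (d'-away-from-v w≢v x≢v) ⟩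
      lookup σ x + surplus c x + d w x             ≡⟨ xy∙z≈xz∙y (lookup σ x) (surplus c x) (d w x) ⟩
      lookup σ x + d w x + surplus c x             ≡⟨ cong₂ _+_ (C.lookup-fire-other σ w x≢w) (surplus-⊕-other c x≢w v≢w) ⟨
      lookup (fire d σ w) x + surplus (c ⊕ w) x    ≡⟨ lookup-lift-other (fire d σ w) (c ⊕ w) x≢v ⟨
      lookup (lift (fire d σ w) (c ⊕ w)) x         ∎
      where
      v≢w : ¬ v ≡ w
      v≢w v≡w = w≢v (sym v≡w)

    fire-lift-v : c v ≡ 0 → fire d' (lift σ c) v ≡ lift (fire d σ v) (c ⊕ v)
    fire-lift-v cv≡0 = lookup-ext entry
      where
      entry : ∀ x → lookup (fire d' (lift σ c) v) x ≡ lookup (lift (fire d σ v) (c ⊕ v)) x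
      entry x with x ≟ v
      ... | yes refl = fire-lift-v-at-v
      ... | no x≢v = fire-lift-v-elsewhere cv≡0 x≢v

    fire-lift-other : ∀ {w} → c w ≡ 0 → ¬ w ≡ v → ¬ w ≡ b →
      fire d' (lift σ c) w ≡ lift (fire d σ w) (c ⊕ w)
    fire-lift-other {w} cw≡0 w≢v w≢b = lookup-ext entry
      where
      entry : ∀ x → lookup (fire d' (lift σ c) w) x ≡ lookup (lift (fire d σ w) (c ⊕ w)) x
      entry x with x ≟ v | x ≟ w
      ... | yes refl | _ = fire-lift-other-at-v w≢v
      ... | no _ | yes refl = fire-lift-other-at-self cw≡0 w≢v w≢b
      ... | no x≢v | no x≢w = fire-lift-other-elsewhere w≢v x≢v x≢w

    fire-lift : ∀ {w} → Fireable d σ w → c w ≡ 0 → fire d' (lift σ c) w ≡ lift (fire d σ w) (c ⊕ w)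
    fire-lift {w} (positive , _) cw≡0 = by-cases (w ≟ v)
      where
      -- a plain 'with w ≟ v' would also abstract the test x ≟ v inside d' w
      by-cases : Dec (w ≡ v) → fire d' (lift σ c) w ≡ lift (fire d σ w) (c ⊕ w)
      by-cases (yes refl) = fire-lift-v cw≡0
      by-cases (no w≢v) = fire-lift-other cw≡0 w≢v (C.positive⇒≢sink b-sink positive)

  outdeg≤outdeg-d' : ∀ x → outdeg d x ≤ outdeg d' x
  outdeg≤outdeg-d' x = subst (outdeg d x ≤_) (sym (outdeg-d' x)) (≤-trans (m≤m+n _ _) (m≤m+n _ _))

  Fireable-lift : ∀ σ c {w} → Fireable d σ w → c w ≡ 0 → Fireable d' (lift σ c) w
  Fireable-lift σ c {w} (positive , enough) cw≡0 =
    <-≤-trans positive (outdeg≤outdeg-d' w) , by-cases (w ≟ v)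
    where
    open ≤-Reasoning
    by-cases : Dec (w ≡ v) → outdeg d' w ≤ lookup (lift σ c) w
    by-cases (yes refl) = begin
      outdeg d' v          ≡⟨ outdeg-d'-v ⟩
      n * outdeg d v       ≤⟨ *-monoʳ-≤ n enough ⟩
      n * lookup σ v       ≡⟨ lookup-lift-v σ c ⟨
      lookup (lift σ c) v  ∎
    by-cases (no w≢v) = begin
      outdeg d' w                  ≡⟨ outdeg-d'-other w≢v ⟩
      outdeg d w + m * d w v       ≤⟨ +-monoˡ-≤ _ enough ⟩
      lookup σ w + m * d w v       ≡⟨ cong (lookup σ w +_) (surplus-unfired c cw≡0 (C.positive⇒≢sink b-sink positive)) ⟨
      lookup σ w + surplus c w     ≡⟨ lookup-lift-other σ c w≢v ⟨
      lookup (lift σ c) w          ∎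

  Fireable-unlift : ∀ σ c {w} → Fireable d' (lift σ c) w → Fireable d σ w
  Fireable-unlift σ c {w} (positive' , enough') = by-cases (w ≟ v)
    where
    open ≤-Reasoning
    by-cases : Dec (w ≡ v) → Fireable d σ w
    by-cases (yes refl) =
      m*n>0⇒n>0 n (subst (0 <_) outdeg-d'-v positive') ,
      *-cancelˡ-≤ n (begin
        n * outdeg d v       ≡⟨ outdeg-d'-v ⟨
        outdeg d' v          ≤⟨ enough' ⟩
        lookup (lift σ c) v  ≡⟨ lookup-lift-v σ c ⟩
        n * lookup σ v       ∎)
    by-cases (no w≢v) = positive , +-cancelʳ-≤ (m * d w v) _ _ (begin
        outdeg d w + m * d w v    ≡⟨ outdeg-d'-other w≢v ⟨
        outdeg d' w               ≤⟨ enough' ⟩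
        lookup (lift σ c) w       ≡⟨ lookup-lift-other σ c w≢v ⟩
        lookup σ w + surplus c w  ≤⟨ +-monoʳ-≤ (lookup σ w) (surplus≤ c (C.positive⇒≢sink b-sink positive)) ⟩
        lookup σ w + m * d w v    ∎)
      where
      positive : 0 < outdeg d w
      positive = m*n>0⇒n>0 n (begin-strict
        0                        <⟨ positive' ⟩
        outdeg d' w              ≡⟨ outdeg-d'-other w≢v ⟩
        outdeg d w + m * d w v   ≤⟨ +-monoʳ-≤ (outdeg d w) (*-monoʳ-≤ m (C.edge≤outdeg w v)) ⟩
        n * outdeg d w           ∎)

  Final-lift : ∀ σ c → Final d σ → Final d' (lift σ c)
  Final-lift σ c final w w-fireable' = final w (Fireable-unlift σ c w-fireable')

  module _ (σ₀ : Config k) (simple : Simple d σ₀) (all-fired : AllButSinkFired d σ₀ b) where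

    σ₀' : Config k
    σ₀' = multConfig d σ₀ v n

    fire-lift-occs : ∀ {q σ w} → FiringSeq d σ₀ q σ → Fireable d σ w →
      fire d' (lift σ (occs q)) w ≡ lift (fire d σ w) (occs (q ++ w ∷ []))
    fire-lift-occs {q} {σ} {w} s w-fireable =
      trans (fire-lift σ (occs q) w-fireable (C.Fireable⇒unfired simple s w-fireable))
            (lift-cong (fire d σ w) λ x → sym (occ-++ x q (w ∷ [])))

    forward : ∀ {q σ ws τ} → FiringSeq d σ₀ q σ → FiringSeq d σ ws τ →
      FiringSeq d' (lift σ (occs q)) ws (lift τ (occs (q ++ ws)))
    forward {q} {σ} s done =
      subst (FiringSeq d' (lift σ (occs q)) []) (cong (λ p → lift σ (occs p)) (sym (++-identityʳ q))) done
    forward {q} {σ} s (step {v = w} {vs = ws} {τ = τ} w-fireable t) =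
      step (Fireable-lift σ (occs q) w-fireable (C.Fireable⇒unfired simple s w-fireable))
        (subst₂ (λ ρ p → FiringSeq d' ρ ws (lift τ (occs p)))
                (sym (fire-lift-occs s w-fireable)) (++-assoc q (w ∷ []) ws)
                (forward (s C.++ᶠ C.[ w-fireable ]ᶠ) t))

    backward : ∀ {q σ ws τ'} → FiringSeq d σ₀ q σ → FiringSeq d' (lift σ (occs q)) ws τ' →
      ∃ λ τ → FiringSeq d σ ws τ × τ' ≡ lift τ (occs (q ++ ws))
    backward {q} {σ} s done = σ , done , cong (λ p → lift σ (occs p)) (sym (++-identityʳ q))
    backward {q} {σ} s (step {v = w} {vs = ws} {τ = τ'} w-fireable' t') =
      let w-fireable = Fireable-unlift σ (occs q) w-fireable'
          τ , t , τ'≡ = backward (s C.++ᶠ C.[ w-fireable ]ᶠ)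
                          (subst (λ ρ → FiringSeq d' ρ ws τ') (fire-lift-occs s w-fireable) t')
      in τ , step w-fireable t , trans τ'≡ (cong (λ p → lift τ (occs p)) (++-assoc q (w ∷ []) ws))

    forward₀ : ∀ {p σ} → FiringSeq d σ₀ p σ → FiringSeq d' σ₀' p (lift σ (occs p))
    forward₀ s = subst (λ ρ → FiringSeq d' ρ _ _) (lift-initial σ₀) (forward done s)

    backward₀ : ∀ {p σ'} → FiringSeq d' σ₀' p σ' → ∃ λ σ → FiringSeq d σ₀ p σ × σ' ≡ lift σ (occs p)
    backward₀ s' = backward done (subst (λ ρ → FiringSeq d' ρ _ _) (sym (lift-initial σ₀)) s')

    Final-unlift : ∀ {q σ} → FiringSeq d σ₀ q σ → Final d' (lift σ (occs q)) → Final d σ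
    Final-unlift {q} {σ} s final' w w-fireable =
      final' w (Fireable-lift σ (occs q) w-fireable (C.Fireable⇒unfired simple s w-fireable))

    execution : ∃ (Execution d σ₀)
    execution = C.Convergent⇒Execution (proj₁ simple)

    execution' : ∃ (Execution d' σ₀')
    execution' =
      let e , τ , s , final = execution in e , lift τ (occs e) , forward₀ s , Final-lift τ (occs e) final

    Execution-unlift : ∀ {e} → Execution d' σ₀' e → Execution d σ₀ e
    Execution-unlift (ρ , s' , final') with backward₀ s'
    ... | τ , s , refl = τ , s , Final-unlift s final'

    executions-agree : C.ExecutionsAgree σ₀
    executions-agree ex ex' x with x ≟ b
    ... | yes refl = trans (C.occ-sink b-sink (proj₁ (proj₂ ex))) (sym (C.occ-sink b-sink (proj₁ (proj₂ ex'))))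
    ... | no x≢b = trans (fired-once ex) (sym (fired-once ex'))
      where
      fired-once : ∀ {e} → Execution d σ₀ e → occ x e ≡ 1
      fired-once {e} ex = ≤-antisym (proj₂ simple e ex x) (all-fired e ex x x≢b)

    executions-agree' : C'.ExecutionsAgree σ₀'
    executions-agree' ex ex' = executions-agree (Execution-unlift ex) (Execution-unlift ex')

    occs-determined : ∀ {P Q ρ} → FiringSeq d σ₀ P ρ → FiringSeq d σ₀ Q ρ → ∀ x → occ x P ≡ occ x Q
    occs-determined = C.occ-determined executions-agree (proj₂ execution)

    occs-determined' : ∀ {P Q ρ} → FiringSeq d' σ₀' P ρ → FiringSeq d' σ₀' Q ρ → ∀ x → occ x P ≡ occ x Q
    occs-determined' = C'.occ-determined executions-agree' (proj₂ execution')

    lift-reached-injective : ∀ {P Q σ₁ σ₂} → FiringSeq d σ₀ P σ₁ → FiringSeq d σ₀ Q σ₂ →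
      lift σ₁ (occs P) ≡ lift σ₂ (occs Q) → σ₁ ≡ σ₂
    lift-reached-injective {P} {Q} {σ₁} {σ₂} s₁ s₂ eq = lift-injective (occs P) (trans eq (lift-cong σ₂ same-occs))
      where
      same-occs : ∀ x → occ x Q ≡ occ x P
      same-occs = occs-determined' (subst (FiringSeq d' σ₀' Q) (sym eq) (forward₀ s₂)) (forward₀ s₁)

    equivalent : Equivalent d σ₀ d' σ₀'
    equivalent = record
      { to = to ; from = from ; from∘to = from∘to ; to∘from = to∘from ; to-mono = to-mono ; to-refl = to-refl }
      where
      to : Space d σ₀ → Space d' σ₀'
      to (σ , r) = let q , s = C.Reach⇒FiringSeq r in lift σ (occs q) , C'.FiringSeq⇒Reach (forward₀ s)

      from : Space d' σ₀' → Space d σ₀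
      from (σ' , r') = let σ , s , _ = backward₀ (proj₂ (C'.Reach⇒FiringSeq r')) in σ , C.FiringSeq⇒Reach s

      from∘to : ∀ x → proj₁ (from (to x)) ≡ proj₁ x
      from∘to (σ , r) =
        let q , s = C.Reach⇒FiringSeq r
            _ , s₁ , eq = backward₀ (proj₂ (C'.Reach⇒FiringSeq (C'.FiringSeq⇒Reach (forward₀ s))))
        in lift-reached-injective s₁ s (sym eq)

      to∘from : ∀ y → proj₁ (to (from y)) ≡ proj₁ y
      to∘from (σ' , r') =
        let σ , s , eq = backward₀ (proj₂ (C'.Reach⇒FiringSeq r'))
        in trans (lift-cong σ (occs-determined (proj₂ (C.Reach⇒FiringSeq (C.FiringSeq⇒Reach s))) s)) (sym eq)

      to-mono : ∀ x y → Reach d (proj₁ x) (proj₁ y) → Reach d' (proj₁ (to x)) (proj₁ (to y))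
      to-mono (σ , r) (τ , r₂) r₁₂ =
        let _ , s = C.Reach⇒FiringSeq r
            _ , s₂ = C.Reach⇒FiringSeq r₂
            ws , t = C.Reach⇒FiringSeq r₁₂
        in C'.FiringSeq⇒Reach
             (subst (FiringSeq d' _ ws) (lift-cong τ (occs-determined (s C.++ᶠ t) s₂)) (forward s t))

      to-refl : ∀ x y → Reach d' (proj₁ (to x)) (proj₁ (to y)) → Reach d (proj₁ x) (proj₁ y)
      to-refl (σ , r) (τ , r₂) r₁₂' =
        let _ , s = C.Reach⇒FiringSeq r
            _ , s₂ = C.Reach⇒FiringSeq r₂
            ws , t' = C'.Reach⇒FiringSeq r₁₂'
            _ , t , eq = backward s t'
        in C.FiringSeq⇒Reach (subst (FiringSeq d σ ws) (lift-reached-injective (s C.++ᶠ t) s₂ (sym eq)) t)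

lemma3 : {k : ℕ} (d : Graph k) (σ₀ : Config k) (b v : Fin k) (n : ℕ) →
    NoLoops d → UniqueSink d b → Simple d σ₀ → AllButSinkFired d σ₀ b →
    ¬ v ≡ b → 1 ≤ n →
    Equivalent d σ₀ (multGraph d b v n) (multConfig d σ₀ v n)
-- of the unique-sink hypothesis only the fact that ⊥ is a sink is needed
lemma3 d σ₀ b v (suc m) noLoops (b-sink , _) simple all-fired v≢b _ =
  Multiplying.equivalent d b v m noLoops b-sink v≢b σ₀ simple all-fired
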